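{- Let $t\ge 2$ and $n\ge 1$ be integers. Then \[ ex(n,n,n,K_{2,t}) \le \frac{3}{2}\, n\Big(1+\sqrt{2(t-1)(n-1)+1}\Big). \]
   Context: $K_{2,t}$ denotes the complete bipartite graph with parts of sizes $2$ and $t$. For an integer $n\ge1$, $ex(n,n,n,K_{2,t})$ is the maximum number of edges in a tripartite graph whose three parts each have exactly $n$ vertices (edges only between distinct parts) and which contains no subgraph isomorphic to $K_{2,t}$. -}

module Defs where

open import Data.Nat using (ℕ; _+_; _*_; _∸_; _≤_; _<ᵇ_)
open import Data.Fin using (Fin; toℕ)
open import Data.Bool using (Bool; true; false; _∧_; if_then_else_)
open import Data.List using (List; allFin; cartesianProduct; map)
open import Data.Nat.ListAction using (sum)
open import Data.Product using (_×_; _,_; proj₁; proj₂; Σ)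
open import Data.Sum using (_⊎_)
open import Function.Definitions using (Injective)
open import Relation.Binary.PropositionalEquality using (_≡_)
open import Relation.Nullary using (¬_)

Vertex : ℕ → Set
Vertex n = Fin 3 × Fin n

part : ∀ {n} → Vertex n → Fin 3
part = proj₁

Adj : ℕ → Set
Adj n = Vertex n → Vertex n → Bool

record IsTripartite {n : ℕ} (G : Adj n) : Set where
  field
    symmetric : ∀ u v → G u v ≡ G v u
    noInnerEdge : ∀ u v → part u ≡ part v → G u v ≡ false

vertices : (n : ℕ) → List (Vertex n)
vertices n = cartesianProduct (allFin 3) (allFin n)

-- Number of edges: each edge {u,v} is counted once, as the ordered pair
-- with part u < part v.
edgeCount : ∀ {n} → Adj n → ℕ
edgeCount {n} G =
  sum (map (λ p → if (toℕ (part (proj₁ p)) <ᵇ toℕ (part (proj₂ p))) ∧ G (proj₁ p) (proj₂ p) then 1 else 0)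
           (cartesianProduct (vertices n) (vertices n)))

-- G contains a (not necessarily induced) subgraph isomorphic to K_{2,t}:
-- two distinct vertices a, b and t distinct vertices c₁,…,c_t, each
-- adjacent to both a and b (adjacency forces cᵢ ∉ {a,b}).
ContainsK2 : ∀ {n} → (t : ℕ) → Adj n → Set
ContainsK2 {n} t G =
  Σ (Vertex n) λ a → Σ (Vertex n) λ b → Σ (Fin t → Vertex n) λ c →
    (¬ a ≡ b) × Injective _≡_ _≡_ c ×
    (∀ i → G a (c i) ≡ true) × (∀ i → G b (c i) ≡ true)

-- The real inequality  e ≤ (3/2) n (1 + √D)  with e, n, D natural numbers,
-- written exactly in ℕ:  2e ≤ 3n + 3n√D  ⇔  2e ≤ 3n  ∨  (2e − 3n)² ≤ 9n²D.
BoundHolds : (e n D : ℕ) → Set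
BoundHolds e n D = (2 * e ≤ 3 * n) ⊎ ((2 * e ∸ 3 * n) * (2 * e ∸ 3 * n) ≤ 9 * (n * n) * D)

{-# OPTIONS --safe #-}
-- Write d_j(u) for the number of neighbours of u in part j, so Σ_u Σ_j d_j(u) = 2e. As d_j(u) = 0
-- for the part j containing u, Cauchy–Schwarz gives (2e)² ≤ 3n · 2 Σ_u Σ_j d_j(u)². Expanding the
-- squares, Σ_u Σ_j d_j(u)² is the sum of the codegrees of all ordered pairs (a, b) of vertices in a
-- common part: the pairs with a = b contribute Σ_a deg a = 2e, and each of the 3n(n − 1) others has
-- codegree at most t − 1 because G has no K_{2,t}. Thus (2e)² ≤ 6n(2e + 3n(n − 1)(t − 1)), and
-- completing the square gives the bound.
module Submission where

open import Defs
open import Data.Nat using (ℕ; zero; suc; _+_; _*_; _∸_; _≤_; _<_; _<ᵇ_; z≤n; _≤?_)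
open import Data.Nat.Properties
open import Data.Nat.ListAction using (sum)
open import Data.Nat.ListAction.Properties using (sum-++)
open import Data.Nat.Tactic.RingSolver using (solve-∀)
open import Algebra.Properties.CommutativeSemigroup +-commutativeSemigroup using (interchange)
import Algebra.Properties.CommutativeMonoid.Sum +-0-commutativeMonoid as Vector
open import Data.Bool using (Bool; true; false; _∧_; if_then_else_; T)
open import Data.Bool.Properties using (∧-idem; ∧-conicalˡ; ∧-conicalʳ) renaming (_≟_ to _≟ᵇ_)
open import Data.Fin using (Fin; zero; suc; toℕ; punchIn; inject≤)
open import Data.Fin.Properties using (toℕ-injective; punchInᵢ≢i; inject≤-injective)
open import Data.List using (List; []; _∷_; _++_; map; length; allFin; tabulate; cartesianProduct; filter; lookup)
open import Data.List.Properties using (map-cong; map-++; map-∘; map-tabulate; length-tabulate; length-++; length-map)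
open import Data.List.Membership.Propositional.Properties using (∈-filter⁻; ∈-lookup)
open import Data.List.Relation.Unary.All as All using ()
open import Data.List.Relation.Unary.AllPairs using (_∷_)
open import Data.List.Relation.Unary.Unique.Propositional using (Unique)
open import Data.List.Relation.Unary.Unique.Propositional.Properties using (filter⁺; cartesianProduct⁺; allFin⁺)
open import Data.Product using (Σ; _×_; _,_; proj₁; proj₂)
open import Data.Sum using (inj₁; inj₂; [_,_]′)
open import Data.Empty using (⊥-elim)
open import Function using (_∘_; id)
open import Function.Definitions using (Injective)
open import Relation.Binary.PropositionalEquality
open import Relation.Nullary using (¬_; yes; no)
open import Relation.Unary using (Decidable)

private variable
  A B : Set

∑ : List A → (A → ℕ) → ℕ
∑ xs f = sum (map f xs)

infix 5 ∑
syntax ∑ xs (λ x → f) = ∑[ x ∈ xs ] f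

∑-cong : (xs : List A) {f g : A → ℕ} → (∀ x → f x ≡ g x) → ∑ xs f ≡ ∑ xs g
∑-cong xs f≗g = cong sum (map-cong f≗g xs)

∑-mono : (xs : List A) {f g : A → ℕ} → (∀ x → f x ≤ g x) → ∑ xs f ≤ ∑ xs g
∑-mono []       f≤g = z≤n
∑-mono (x ∷ xs) f≤g = +-mono-≤ (f≤g x) (∑-mono xs f≤g)

∑-const : (xs : List A) (c : ℕ) → ∑[ x ∈ xs ] c ≡ length xs * c
∑-const []       c = refl
∑-const (x ∷ xs) c = cong (c +_) (∑-const xs c)

∑-zero : (xs : List A) → ∑[ x ∈ xs ] 0 ≡ 0
∑-zero xs = trans (∑-const xs 0) (*-zeroʳ (length xs))

∑-distrib-+ : (xs : List A) (f g : A → ℕ) → ∑[ x ∈ xs ] (f x + g x) ≡ ∑ xs f + ∑ xs g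
∑-distrib-+ []       f g = refl
∑-distrib-+ (x ∷ xs) f g =
  trans (cong (f x + g x +_) (∑-distrib-+ xs f g)) (interchange (f x) (g x) (∑ xs f) (∑ xs g))

∑-*ˡ : (xs : List A) (c : ℕ) (f : A → ℕ) → c * ∑ xs f ≡ ∑[ x ∈ xs ] c * f x
∑-*ˡ []       c f = *-zeroʳ c
∑-*ˡ (x ∷ xs) c f = trans (*-distribˡ-+ c (f x) (∑ xs f)) (cong (c * f x +_) (∑-*ˡ xs c f))

∑-++ : (xs ys : List A) (f : A → ℕ) → ∑ (xs ++ ys) f ≡ ∑ xs f + ∑ ys f
∑-++ xs ys f = trans (cong sum (map-++ f xs ys)) (sum-++ (map f xs) (map f ys))

∑-map : (xs : List A) (g : A → B) (f : B → ℕ) → ∑ (map g xs) f ≡ ∑[ x ∈ xs ] f (g x)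
∑-map xs g f = cong sum (sym (map-∘ xs))

∑-cartesianProduct : (xs : List A) (ys : List B) (f : A × B → ℕ) →
  ∑ (cartesianProduct xs ys) f ≡ ∑[ x ∈ xs ] ∑[ y ∈ ys ] f (x , y)
∑-cartesianProduct []       ys f = refl
∑-cartesianProduct (x ∷ xs) ys f =
  trans (∑-++ (map (x ,_) ys) (cartesianProduct xs ys) f)
        (cong₂ _+_ (∑-map ys (x ,_) f) (∑-cartesianProduct xs ys f))

∑-comm : (xs : List A) (ys : List B) (f : A → B → ℕ) →
  ∑[ x ∈ xs ] ∑[ y ∈ ys ] f x y ≡ ∑[ y ∈ ys ] ∑[ x ∈ xs ] f x y
∑-comm []       ys f = sym (∑-zero ys)
∑-comm (x ∷ xs) ys f =
  trans (cong (∑ ys (f x) +_) (∑-comm xs ys f)) (sym (∑-distrib-+ ys (f x) _))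

∑-*-∑ : (xs : List A) (ys : List B) (f : A → ℕ) (g : B → ℕ) →
  ∑ xs f * ∑ ys g ≡ ∑[ x ∈ xs ] ∑[ y ∈ ys ] f x * g y
∑-*-∑ []       ys f g = refl
∑-*-∑ (x ∷ xs) ys f g =
  trans (*-distribʳ-+ (∑ ys g) (f x) (∑ xs f)) (cong₂ _+_ (∑-*ˡ ys (f x) g) (∑-*-∑ xs ys f g))

length-cartesianProduct : (xs : List A) (ys : List B) →
  length (cartesianProduct xs ys) ≡ length xs * length ys
length-cartesianProduct []       ys = refl
length-cartesianProduct (x ∷ xs) ys = begin
  length (map (x ,_) ys ++ cartesianProduct xs ys)        ≡⟨ length-++ (map (x ,_) ys) ⟩
  length (map (x ,_) ys) + length (cartesianProduct xs ys) ≡⟨ cong₂ _+_ (length-map (x ,_) ys) (length-cartesianProduct xs ys) ⟩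
  length ys + length xs * length ys                        ∎
  where open ≡-Reasoning

2mn≤m²+n² : ∀ m n → 2 * (m * n) ≤ m * m + n * n
2mn≤m²+n² m n = [ ordered , flipped ]′ (≤-total m n)
  where
  ordered : ∀ {m n} → m ≤ n → 2 * (m * n) ≤ m * m + n * n
  ordered {m} m≤n with d , refl ← m≤n⇒∃[o]m+o≡n m≤n =
    subst (2 * (m * (m + d)) ≤_) (sym (square-gap m d)) (m≤m+n _ (d * d))
    where
    square-gap : ∀ m d → m * m + (m + d) * (m + d) ≡ 2 * (m * (m + d)) + d * d
    square-gap = solve-∀

  flipped : n ≤ m → 2 * (m * n) ≤ m * m + n * n
  flipped n≤m = subst₂ (λ a b → 2 * a ≤ b) (*-comm n m) (+-comm (n * n) (m * m)) (ordered n≤m)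

cauchy-schwarz : (xs : List A) (f : A → ℕ) → ∑ xs f * ∑ xs f ≤ length xs * (∑[ x ∈ xs ] f x * f x)
cauchy-schwarz xs f = *-cancelˡ-≤ 2 (begin
  2 * (∑ xs f * ∑ xs f)                               ≡⟨ cong (2 *_) (∑-*-∑ xs xs f f) ⟩
  2 * (∑[ x ∈ xs ] ∑[ y ∈ xs ] f x * f y)             ≡⟨ ∑-*ˡ xs 2 _ ⟩
  ∑[ x ∈ xs ] 2 * (∑[ y ∈ xs ] f x * f y)             ≡⟨ ∑-cong xs (λ x → ∑-*ˡ xs 2 _) ⟩
  ∑[ x ∈ xs ] ∑[ y ∈ xs ] 2 * (f x * f y)             ≤⟨ ∑-mono xs (λ x → ∑-mono xs (λ y → 2mn≤m²+n² (f x) (f y))) ⟩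
  ∑[ x ∈ xs ] ∑[ y ∈ xs ] (f x * f x + f y * f y)     ≡⟨ ∑-cong xs (λ x → ∑-distrib-+ xs _ _) ⟩
  ∑[ x ∈ xs ] ((∑[ y ∈ xs ] f x * f x) + Q)           ≡⟨ ∑-distrib-+ xs _ _ ⟩
  (∑[ x ∈ xs ] ∑[ y ∈ xs ] f x * f x) + (∑[ x ∈ xs ] Q) ≡⟨ cong₂ _+_ (∑-cong xs (λ x → ∑-const xs (f x * f x))) (∑-const xs Q) ⟩
  (∑[ x ∈ xs ] L * (f x * f x)) + L * Q               ≡⟨ cong (_+ L * Q) (∑-*ˡ xs L _) ⟨
  L * Q + L * Q                                       ≡⟨ cong (L * Q +_) (+-identityʳ (L * Q)) ⟨
  2 * (L * Q)                                         ∎)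
  where
  open ≤-Reasoning
  L Q : ℕ
  L = length xs
  Q = ∑[ x ∈ xs ] f x * f x

∑-allFin : ∀ {m} (f : Fin m → ℕ) → ∑ (allFin m) f ≡ Vector.sum f
∑-allFin f = trans (cong sum (map-tabulate id f)) (sum-tabulate f)
  where
  sum-tabulate : ∀ {m} (f : Fin m → ℕ) → sum (tabulate f) ≡ Vector.sum f
  sum-tabulate {zero}  f = refl
  sum-tabulate {suc m} f = cong (f zero +_) (sum-tabulate (f ∘ suc))

∑-allFin-const : ∀ m c → ∑[ i ∈ allFin m ] c ≡ m * c
∑-allFin-const m c = trans (∑-const (allFin m) c) (cong (_* c) (length-tabulate {n = m} id))

∑-allFin-punchIn : ∀ {m} (i : Fin (suc m)) (f : Fin (suc m) → ℕ) →
  ∑ (allFin (suc m)) f ≡ f i + (∑[ j ∈ allFin m ] f (punchIn i j))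
∑-allFin-punchIn i f = begin
  ∑ (allFin _) f                    ≡⟨ ∑-allFin f ⟩
  Vector.sum f                      ≡⟨ Vector.sum-remove {i = i} f ⟩
  f i + Vector.sum (f ∘ punchIn i)  ≡⟨ cong (f i +_) (∑-allFin (f ∘ punchIn i)) ⟨
  f i + (∑[ j ∈ allFin _ ] f (punchIn i j)) ∎
  where open ≡-Reasoning

∑-allFin-≤-punctured : ∀ {n} (i : Fin n) (f : Fin n → ℕ) {K} → (∀ j → j ≢ i → f j ≤ K) →
  ∑ (allFin n) f ≤ f i + (n ∸ 1) * K
∑-allFin-≤-punctured {suc m} i f {K} f≤K = begin
  ∑ (allFin (suc m)) f                     ≡⟨ ∑-allFin-punchIn i f ⟩
  f i + (∑[ j ∈ allFin m ] f (punchIn i j)) ≤⟨ +-monoʳ-≤ (f i) (∑-mono (allFin m) (λ j → f≤K (punchIn i j) (punchInᵢ≢i i j))) ⟩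
  f i + (∑[ j ∈ allFin m ] K)              ≡⟨ cong (f i +_) (∑-allFin-const m K) ⟩
  f i + m * K                              ∎
  where open ≤-Reasoning

cauchy-schwarz-punctured : ∀ {m} (i : Fin (suc m)) (f : Fin (suc m) → ℕ) → f i ≡ 0 →
  ∑ (allFin (suc m)) f * ∑ (allFin (suc m)) f ≤ m * (∑[ j ∈ allFin (suc m) ] f j * f j)
cauchy-schwarz-punctured {m} i f fi≡0 = begin
  S * S                                                      ≡⟨ cong (λ s → s * s) S≡S′ ⟩
  S′ * S′                                                    ≤⟨ cauchy-schwarz (allFin m) (f ∘ punchIn i) ⟩
  length (allFin m) * (∑[ j ∈ allFin m ] f′ j * f′ j)        ≡⟨ cong (_* (∑[ j ∈ allFin m ] f′ j * f′ j)) (length-tabulate {n = m} id) ⟩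
  m * (∑[ j ∈ allFin m ] f′ j * f′ j)                        ≤⟨ *-monoʳ-≤ m (m≤n+m _ (f i * f i)) ⟩
  m * (f i * f i + (∑[ j ∈ allFin m ] f′ j * f′ j))          ≡⟨ cong (m *_) (∑-allFin-punchIn i (λ j → f j * f j)) ⟨
  m * (∑[ j ∈ allFin (suc m) ] f j * f j)                    ∎
  where
  open ≤-Reasoning
  f′ : Fin m → ℕ
  f′ = f ∘ punchIn i
  S S′ : ℕ
  S  = ∑ (allFin (suc m)) f
  S′ = ∑ (allFin m) f′
  S≡S′ : S ≡ S′
  S≡S′ = trans (∑-allFin-punchIn i f) (cong (_+ S′) fi≡0)

𝟙 : Bool → ℕ
𝟙 b = if b then 1 else 0

𝟙-∧ : ∀ a b → 𝟙 (a ∧ b) ≡ 𝟙 a * 𝟙 b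
𝟙-∧ true  b = sym (+-identityʳ (𝟙 b))
𝟙-∧ false b = refl

𝟙-square : ∀ b → 𝟙 b * 𝟙 b ≡ 𝟙 b
𝟙-square b = trans (sym (𝟙-∧ b b)) (cong 𝟙 (∧-idem b))

<ᵇ≡true⇒< : ∀ i j → (i <ᵇ j) ≡ true → i < j
<ᵇ≡true⇒< i j eq = <ᵇ⇒< i j (subst T (sym eq) _)

<ᵇ≡false⇒≥ : ∀ i j → (i <ᵇ j) ≡ false → j ≤ i
<ᵇ≡false⇒≥ i j eq = ≮⇒≥ (subst T eq ∘ <⇒<ᵇ)

𝟙-split : ∀ i j b → (i ≡ j → b ≡ false) → 𝟙 b ≡ 𝟙 ((i <ᵇ j) ∧ b) + 𝟙 ((j <ᵇ i) ∧ b)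
𝟙-split i j b i≡j⇒¬b with i <ᵇ j in i<j | j <ᵇ i in j<i
... | true  | true  = ⊥-elim (<-asym (<ᵇ≡true⇒< i j i<j) (<ᵇ≡true⇒< j i j<i))
... | true  | false = sym (+-identityʳ (𝟙 b))
... | false | true  = refl
... | false | false = cong 𝟙 (i≡j⇒¬b (≤-antisym (<ᵇ≡false⇒≥ j i j<i) (<ᵇ≡false⇒≥ i j i<j)))

length-filter : (p : A → Bool) (xs : List A) →
  length (filter (λ x → p x ≟ᵇ true) xs) ≡ ∑[ x ∈ xs ] 𝟙 (p x)
length-filter p []       = refl
length-filter p (x ∷ xs) with p x
... | true  = cong suc (length-filter p xs)
... | false = length-filter p xs

lookup-injective : {xs : List A} → Unique xs → Injective _≡_ _≡_ (lookup xs)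
lookup-injective (x∉xs ∷ unique) {zero}  {zero}  eq = refl
lookup-injective (x∉xs ∷ unique) {zero}  {suc j} eq = ⊥-elim (All.lookup x∉xs (∈-lookup j) eq)
lookup-injective (x∉xs ∷ unique) {suc i} {zero}  eq = ⊥-elim (All.lookup x∉xs (∈-lookup i) (sym eq))
lookup-injective (x∉xs ∷ unique) {suc i} {suc j} eq = cong suc (lookup-injective unique eq)

distinct-witnesses : {xs : List A} → Unique xs → (p : A → Bool) {t : ℕ} → t ≤ ∑[ x ∈ xs ] 𝟙 (p x) →
  Σ (Fin t → A) λ c → Injective _≡_ _≡_ c × (∀ i → p (c i) ≡ true)
distinct-witnesses {A = A} {xs = xs} unique p {t} t≤count = c , c-injective , c-satisfies
  where
  p? : Decidable (λ x → p x ≡ true)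
  p? x = p x ≟ᵇ true
  t≤length : t ≤ length (filter p? xs)
  t≤length = subst (t ≤_) (sym (length-filter p xs)) t≤count
  c : Fin t → A
  c i = lookup (filter p? xs) (inject≤ i t≤length)
  c-injective : Injective _≡_ _≡_ c
  c-injective eq = inject≤-injective _ _ _ _ (lookup-injective (filter⁺ p? unique) eq)
  c-satisfies : ∀ i → p (c i) ≡ true
  c-satisfies i = proj₂ (∈-filter⁻ p? {xs = xs} (∈-lookup (inject≤ i t≤length)))

bound-from-quadratic : ∀ e n T N → 2 * e * (2 * e) ≤ 3 * n * (2 * (2 * e + 3 * n * (N * T))) →
  BoundHolds e n (2 * T * N + 1)
bound-from-quadratic e n T N quadratic with 2 * e ≤? 3 * n
... | yes 2e≤3n = inj₁ 2e≤3n
... | no  2e≰3n = inj₂ (+-cancelʳ-≤ (6 * n * m + 9 * (n * n)) _ _ expanded)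
  where
  m : ℕ
  m = 2 * e ∸ 3 * n
  2e≡m+3n : 2 * e ≡ m + 3 * n
  2e≡m+3n = sym (m∸n+n≡m (≰⇒≥ 2e≰3n))
  expand-lhs : ∀ m n → (m + 3 * n) * (m + 3 * n) ≡ m * m + (6 * n * m + 9 * (n * n))
  expand-lhs = solve-∀
  expand-rhs : ∀ m n T N →
    3 * n * (2 * (m + 3 * n + 3 * n * (N * T))) ≡ 9 * (n * n) * (2 * T * N + 1) + (6 * n * m + 9 * (n * n))
  expand-rhs = solve-∀
  expanded : m * m + (6 * n * m + 9 * (n * n)) ≤ 9 * (n * n) * (2 * T * N + 1) + (6 * n * m + 9 * (n * n))
  expanded = subst₂ _≤_ (expand-lhs m n) (expand-rhs m n T N)
    (subst (λ x → x * x ≤ 3 * n * (2 * (x + 3 * n * (N * T)))) 2e≡m+3n quadratic)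

length-vertices : ∀ n → length (vertices n) ≡ 3 * n
length-vertices n = trans (length-cartesianProduct (allFin 3) (allFin n))
                          (cong₂ _*_ (length-tabulate {n = 3} id) (length-tabulate {n = n} id))

unique-vertices : ∀ n → Unique (vertices n)
unique-vertices n = cartesianProduct⁺ (allFin⁺ 3) (allFin⁺ n)

module _ {n : ℕ} (G : Adj n) (tripartite : IsTripartite G) where
  open IsTripartite tripartite

  private
    V : List (Vertex n)
    V = vertices n

  edge : Vertex n → Vertex n → ℕ
  edge u v = 𝟙 (G u v)

  degree : Vertex n → ℕ
  degree u = ∑[ v ∈ V ] edge u v

  degreeInto : Vertex n → Fin 3 → ℕ
  degreeInto u j = ∑[ b ∈ allFin n ] edge u (j , b)

  codegree : Vertex n → Vertex n → ℕ
  codegree x y = ∑[ u ∈ V ] edge u x * edge u y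

  oriented : Vertex n × Vertex n → ℕ
  oriented p = 𝟙 ((toℕ (part (proj₁ p)) <ᵇ toℕ (part (proj₂ p))) ∧ G (proj₁ p) (proj₂ p))

  edge-oriented : ∀ u v → edge u v ≡ oriented (u , v) + oriented (v , u)
  edge-oriented u v rewrite symmetric v u =
    𝟙-split (toℕ (part u)) (toℕ (part v)) (G u v) (noInnerEdge u v ∘ toℕ-injective)

  handshake : ∑[ u ∈ V ] degree u ≡ 2 * edgeCount G
  handshake = begin
    ∑[ u ∈ V ] ∑[ v ∈ V ] edge u v                                       ≡⟨ ∑-cong V (λ u → ∑-cong V (edge-oriented u)) ⟩
    ∑[ u ∈ V ] ∑[ v ∈ V ] (oriented (u , v) + oriented (v , u))          ≡⟨ ∑-cong V (λ u → ∑-distrib-+ V _ _) ⟩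
    ∑[ u ∈ V ] ((∑[ v ∈ V ] oriented (u , v)) + (∑[ v ∈ V ] oriented (v , u))) ≡⟨ ∑-distrib-+ V _ _ ⟩
    E + (∑[ u ∈ V ] ∑[ v ∈ V ] oriented (v , u))                         ≡⟨ cong (E +_) (∑-comm V V _) ⟩
    E + E                                                                ≡⟨ cong (E +_) (+-identityʳ E) ⟨
    2 * E                                                                ≡⟨ cong (2 *_) (∑-cartesianProduct V V oriented) ⟨
    2 * edgeCount G                                                      ∎
    where
    open ≡-Reasoning
    E : ℕ
    E = ∑[ u ∈ V ] ∑[ v ∈ V ] oriented (u , v)

  degree-by-parts : ∀ u → degree u ≡ ∑[ j ∈ allFin 3 ] degreeInto u j
  degree-by-parts u = ∑-cartesianProduct (allFin 3) (allFin n) (edge u)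

  degreeInto-own-part : ∀ u → degreeInto u (part u) ≡ 0
  degreeInto-own-part u =
    trans (∑-cong (allFin n) (λ b → cong 𝟙 (noInnerEdge u (part u , b) refl))) (∑-zero (allFin n))

  degree²≤ : ∀ u → degree u * degree u ≤ 2 * (∑[ j ∈ allFin 3 ] degreeInto u j * degreeInto u j)
  degree²≤ u rewrite degree-by-parts u =
    cauchy-schwarz-punctured (part u) (degreeInto u) (degreeInto-own-part u)

  codegree-self : ∀ v → codegree v v ≡ degree v
  codegree-self v = ∑-cong V (λ u → trans (𝟙-square (G u v)) (cong 𝟙 (symmetric u v)))

  t≤codegree⇒ContainsK2 : ∀ {t x y} → x ≢ y → t ≤ codegree x y → ContainsK2 t G
  t≤codegree⇒ContainsK2 {t} {x} {y} x≢y t≤codegree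
    with c , c-injective , common ← distinct-witnesses (unique-vertices n) (λ u → G u x ∧ G u y)
                                      (subst (t ≤_) (∑-cong V (λ u → sym (𝟙-∧ (G u x) (G u y)))) t≤codegree)
    = x , y , c , x≢y , c-injective
    , (λ i → trans (symmetric x (c i)) (∧-conicalˡ _ _ (common i)))
    , (λ i → trans (symmetric y (c i)) (∧-conicalʳ _ _ (common i)))

  codegree≤ : ∀ {t x y} → ¬ ContainsK2 t G → x ≢ y → codegree x y ≤ t ∸ 1
  codegree≤ noK x≢y = ∸-monoˡ-≤ 1 (≰⇒> (noK ∘ t≤codegree⇒ContainsK2 x≢y))

  ∑-degreeInto²≡∑-codegree :
    ∑[ u ∈ V ] ∑[ j ∈ allFin 3 ] degreeInto u j * degreeInto u j
      ≡ ∑[ j ∈ allFin 3 ] ∑[ a ∈ allFin n ] ∑[ b ∈ allFin n ] codegree (j , a) (j , b)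
  ∑-degreeInto²≡∑-codegree = begin
    ∑[ u ∈ V ] ∑[ j ∈ allFin 3 ] degreeInto u j * degreeInto u j
      ≡⟨ ∑-cong V (λ u → ∑-cong (allFin 3) (λ j → ∑-*-∑ (allFin n) (allFin n) (λ a → edge u (j , a)) (λ b → edge u (j , b)))) ⟩
    ∑[ u ∈ V ] ∑[ j ∈ allFin 3 ] ∑[ a ∈ allFin n ] ∑[ b ∈ allFin n ] common u j a b
      ≡⟨ ∑-comm V (allFin 3) (λ u j → ∑[ a ∈ allFin n ] ∑[ b ∈ allFin n ] common u j a b) ⟩
    ∑[ j ∈ allFin 3 ] ∑[ u ∈ V ] ∑[ a ∈ allFin n ] ∑[ b ∈ allFin n ] common u j a b
      ≡⟨ ∑-cong (allFin 3) (λ j → ∑-comm V (allFin n) (λ u a → ∑[ b ∈ allFin n ] common u j a b)) ⟩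
    ∑[ j ∈ allFin 3 ] ∑[ a ∈ allFin n ] ∑[ u ∈ V ] ∑[ b ∈ allFin n ] common u j a b
      ≡⟨ ∑-cong (allFin 3) (λ j → ∑-cong (allFin n) (λ a → ∑-comm V (allFin n) (λ u b → common u j a b))) ⟩
    ∑[ j ∈ allFin 3 ] ∑[ a ∈ allFin n ] ∑[ b ∈ allFin n ] ∑[ u ∈ V ] common u j a b
      ∎
    where
    open ≡-Reasoning
    common : Vertex n → Fin 3 → Fin n → Fin n → ℕ
    common u j a b = edge u (j , a) * edge u (j , b)

  ∑-codegree-within-parts≤ : ∀ {t} → ¬ ContainsK2 t G →
    ∑[ j ∈ allFin 3 ] ∑[ a ∈ allFin n ] ∑[ b ∈ allFin n ] codegree (j , a) (j , b)
      ≤ 2 * edgeCount G + 3 * n * ((n ∸ 1) * (t ∸ 1))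
  ∑-codegree-within-parts≤ {t} noK = begin
    ∑[ j ∈ allFin 3 ] ∑[ a ∈ allFin n ] ∑[ b ∈ allFin n ] codegree (j , a) (j , b)
      ≤⟨ ∑-mono (allFin 3) (λ j → ∑-mono (allFin n) (λ a →
           ∑-allFin-≤-punctured a (λ b → codegree (j , a) (j , b)) (λ b b≢a → codegree≤ noK (b≢a ∘ sym ∘ cong proj₂)))) ⟩
    ∑[ j ∈ allFin 3 ] ∑[ a ∈ allFin n ] (codegree (j , a) (j , a) + K)
      ≡⟨ ∑-cartesianProduct (allFin 3) (allFin n) (λ v → codegree v v + K) ⟨
    ∑[ v ∈ V ] (codegree v v + K)
      ≡⟨ ∑-distrib-+ V _ _ ⟩
    (∑[ v ∈ V ] codegree v v) + (∑[ v ∈ V ] K)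
      ≡⟨ cong₂ _+_ (trans (∑-cong V codegree-self) handshake)
                   (trans (∑-const V K) (cong (_* K) (length-vertices n))) ⟩
    2 * edgeCount G + 3 * n * K
      ∎
    where
    open ≤-Reasoning
    K : ℕ
    K = (n ∸ 1) * (t ∸ 1)

-- The argument does not need 2 ≤ t or 1 ≤ n.
theorem1 : (t n : ℕ) → 2 ≤ t → 1 ≤ n → (G : Adj n) → IsTripartite G → ¬ ContainsK2 t G →
    BoundHolds (edgeCount G) n (2 * (t ∸ 1) * (n ∸ 1) + 1)
theorem1 t n _ _ G tripartite noK = bound-from-quadratic (edgeCount G) n (t ∸ 1) (n ∸ 1) (begin
  2 * e * (2 * e)                                          ≡⟨ cong (λ s → s * s) (handshake G tripartite) ⟨
  ∑ V deg * ∑ V deg                                        ≤⟨ cauchy-schwarz V deg ⟩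
  length V * (∑[ u ∈ V ] deg u * deg u)                    ≡⟨ cong (_* (∑[ u ∈ V ] deg u * deg u)) (length-vertices n) ⟩
  3 * n * (∑[ u ∈ V ] deg u * deg u)                       ≤⟨ *-monoʳ-≤ (3 * n) (∑-mono V (degree²≤ G tripartite)) ⟩
  3 * n * (∑[ u ∈ V ] 2 * Q u)                             ≡⟨ cong (3 * n *_) (∑-*ˡ V 2 Q) ⟨
  3 * n * (2 * ∑ V Q)                                      ≡⟨ cong (λ s → 3 * n * (2 * s)) (∑-degreeInto²≡∑-codegree G tripartite) ⟩
  3 * n * (2 * (∑[ j ∈ allFin 3 ] ∑[ a ∈ allFin n ] ∑[ b ∈ allFin n ] codegree G tripartite (j , a) (j , b)))
                                                           ≤⟨ *-monoʳ-≤ (3 * n) (*-monoʳ-≤ 2 (∑-codegree-within-parts≤ G tripartite noK)) ⟩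
  3 * n * (2 * (2 * e + 3 * n * ((n ∸ 1) * (t ∸ 1))))      ∎)
  where
  open ≤-Reasoning
  e : ℕ
  e = edgeCount G
  V : List (Vertex n)
  V = vertices n
  deg Q : Vertex n → ℕ
  deg = degree G tripartite
  Q u = ∑[ j ∈ allFin 3 ] degreeInto G tripartite u j * degreeInto G tripartite u j
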